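{- For an integer $k\geq 2$, let $N^{SF}_k\subset\mathfrak{h}^1[t]$ be the $\mathbb{Q}[t]$-submodule generated by the elements $S^t(x_{k,n})-P_{k,n}(t)z_k$ for all integers $1\leq n<k$. Then $N^{SF}_k$ is a differential submodule, i.e., it is closed under $\frac{d}{dt}$.
   Context: $\mathfrak{h}^1=\mathbb{Q}\langle z_1,z_2,\ldots\rangle$ is the non-commutative polynomial algebra on letters $z_k$ ($k\geq 1$), with $z_k\circ z_l=z_{k+l}$ extended to an action on $\mathfrak{h}^1[t]$ by $z_k\circ 1=0$, $z_k\circ(z_lw)=z_{k+l}w$ and linearity. $S^t$ is the $\mathbb{Q}[t]$-linear operator on $\mathfrak{h}^1[t]$ with $S^t(1)=1$ and $S^t(z_kw)=z_kS^t(w)+t\,z_k\circ S^t(w)$ for words $w$. For integers $k>n\geq1$, $x_{k,n}=\sum z_{k_1}\cdots z_{k_n}$, summed over $k_1\geq 2$, $k_2,\ldots,k_n\geq 1$ with $k_1+\cdots+k_n=k$, and $P_{k,n}(t)=\sum_{j=0}^{n-1}\binom{k-1}{j}t^j(1-t)^{n-1-j}$. -}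

module Defs where

open import Data.Nat as ℕ using (ℕ; zero; suc; _∸_; _≤_; _≡ᵇ_; _≤ᵇ_)
open import Data.Nat.Combinatorics using (_C_)
open import Data.Integer using (+_)
open import Data.Rational as ℚ using (ℚ; 0ℚ; 1ℚ; _/_)
open import Data.List using (List; []; _∷_; map; concatMap; filter; foldr; upTo; _++_)
open import Data.List.Properties using (≡-dec)
open import Data.Product using (_×_; _,_; Σ)
open import Data.Bool using (Bool; true; false; if_then_else_; _∧_)
open import Relation.Nullary.Decidable using (⌊_⌋)
open import Relation.Binary.PropositionalEquality using (_≡_)

-- Words in the letters z_k.  The letter z_k is represented by the
-- natural number k (only k ≥ 1 ever occurs in the objects below).
Word : Set
Word = List ℕ

_≟w_ : (v w : Word) → Bool
v ≟w w = ⌊ ≡-dec ℕ._≟_ v w ⌋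

fromℕ : ℕ → ℚ
fromℕ n = (+ n) / 1

-- Elements of h¹[t] = ℚ⟨z₁,z₂,…⟩[t] as formal finite sums of terms
-- c · t^j · w  (c ∈ ℚ, j ∈ ℕ, w a word), i.e. a list of (c , j , w).
Term : Set
Term = ℚ × ℕ × Word

H1t : Set
H1t = List Term

coeff : H1t → Word → ℕ → ℚ
coeff f w j = foldr step 0ℚ f
  where
  step : Term → ℚ → ℚ
  step (c , i , v) acc = if (i ≡ᵇ j) ∧ (v ≟w w) then c ℚ.+ acc else acc

_≈_ : H1t → H1t → Set
f ≈ g = ∀ (w : Word) (j : ℕ) → coeff f w j ≡ coeff g w j

-- ℚ[t] as formal sums of terms c · t^j
QT : Set
QT = List (ℚ × ℕ)

_*QT_ : QT → QT → QT
p *QT q = concatMap (λ { (a , i) → map (λ { (b , j) → (a ℚ.* b , i ℕ.+ j) }) q }) p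

powQT : QT → ℕ → QT
powQT p zero = (1ℚ , 0) ∷ []
powQT p (suc m) = p *QT powQT p m

_·_ : QT → H1t → H1t
p · f = concatMap (λ { (a , i) → map (λ { (c , j , w) → (a ℚ.* c , i ℕ.+ j , w) }) f }) p

zH : ℕ → H1t
zH k = (1ℚ , 0 , k ∷ []) ∷ []

zcons : ℕ → H1t → H1t
zcons a f = map (λ { (c , j , w) → (c , j , a ∷ w) }) f

-- z_a ∘ (−):  z_a ∘ 1 = 0,  z_a ∘ (z_b w) = z_{a+b} w, extended linearly
circ : ℕ → H1t → H1t
circ a f = concatMap step f
  where
  step : Term → H1t
  step (c , j , []) = []
  step (c , j , b ∷ w) = (c , j , (a ℕ.+ b) ∷ w) ∷ []

timesT : H1t → H1t
timesT f = map (λ { (c , j , w) → (c , suc j , w) }) f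

Stw : Word → H1t
Stw [] = (1ℚ , 0 , []) ∷ []
Stw (a ∷ w) = zcons a (Stw w) ++ timesT (circ a (Stw w))

St : H1t → H1t
St f = concatMap (λ { (c , j , w) → ((c , j) ∷ []) · Stw w }) f

ddt : H1t → H1t
ddt f = map (λ { (c , j , w) → (c ℚ.* fromℕ j , j ∸ 1 , w) }) f

-- compositions of m into n positive parts
comps : ℕ → ℕ → List (List ℕ)
comps zero zero = [] ∷ []
comps zero (suc m) = []
comps (suc n) m = concatMap (λ a → map (a ∷_) (comps n (m ∸ a))) (map suc (upTo m))

headGe2 : List ℕ → Bool
headGe2 [] = false
headGe2 (a ∷ _) = 2 ≤ᵇ a

x : ℕ → ℕ → H1t
x k n = map (λ w → (1ℚ , 0 , w)) (filter (λ w → headGe2 w Data.Bool.≟ true) (comps n k))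
  where import Data.Bool

oneMinusT : QT
oneMinusT = (1ℚ , 0) ∷ (ℚ.- 1ℚ , 1) ∷ []

P : ℕ → ℕ → QT
P k n = concatMap (λ j → ((fromℕ ((k ∸ 1) C j) , j) ∷ []) *QT powQT oneMinusT (n ∸ 1 ∸ j)) (upTo n)

gen : ℕ → ℕ → H1t
gen k n = St (x k n) ++ (((ℚ.- 1ℚ , 0) ∷ []) · (P k n · zH k))

InNSF : ℕ → H1t → Set
InNSF k f = Σ (ℕ → QT) λ c → f ≈ concatMap (λ n → c n · gen k n) (map suc (upTo (k ∸ 1)))

module Submission where

-- The key identity is
--     d/dt gen_{k,n+1} = (k − n − 1) gen_{k,n},      gen_{k,0} = 0,
-- after which the Leibniz rule gives
--     d/dt Σ_n c_n gen_{k,n} = Σ_n (dc_n/dt + (k − n − 1) c_{n+1}) gen_{k,n}.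
-- Elements of h¹[t] are formal sums compared coefficientwise, so every
-- identity is proved for the pairing ⟪ φ ∣ f ⟫ with an arbitrary weight φ
-- on monomials t^j·w, each operation being moved onto φ as its adjoint.

open import Defs
open import Data.Nat as ℕ using (ℕ; zero; suc; _∸_; _≤_; _<_; _≡ᵇ_)
import Data.Nat.Properties as ℕP
open import Data.Nat.Combinatorics using (_C_; nC1≡n; nCk+nC[k+1]≡[n+1]C[k+1])
import Data.Integer as ℤ
import Data.Integer.Properties as ℤP
open import Data.Rational as ℚ using (ℚ; 0ℚ; 1ℚ; _+_; _*_; -_; _-_; toℚᵘ)
import Data.Rational.Properties as ℚP
import Data.Rational.Unnormalised as ℚᵘ
import Data.Rational.Unnormalised.Properties as ℚᵘP
open import Data.List using (List; []; _∷_; map; concatMap; filter; upTo; applyUpTo; _++_)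
open import Data.List.Properties using (upTo-∷ʳ; map-applyUpTo; ++-identityʳ)
open import Data.Product using (_×_; _,_; proj₁; proj₂)
open import Data.Bool using (true; false; if_then_else_; _∧_; T)
import Data.Bool as Bool
open import Data.Unit using (tt)
open import Relation.Unary using (Decidable)
open import Relation.Nullary using (does)
open import Relation.Binary.PropositionalEquality
open import Data.Rational.Solver using (module +-*-Solver)
open +-*-Solver
open import Data.Nat.Solver using () renaming (module +-*-Solver to ℕSolver)
open ℕSolver using () renaming (solve to solveℕ; _:+_ to _⊕_; _:*_ to _⊛_; _:=_ to _≐_; con to conℕ)

fromℕ-+ : ∀ m n → fromℕ (m ℕ.+ n) ≡ fromℕ m + fromℕ n
fromℕ-+ m n = ℚP.toℚᵘ-injective (begin
    toℚᵘ (fromℕ (m ℕ.+ n))               ≈⟨ ℚP.toℚᵘ-fromℚᵘ (ℚᵘ.mkℚᵘ (ℤ.+ (m ℕ.+ n)) 0) ⟩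
    ℚᵘ.mkℚᵘ (ℤ.+ (m ℕ.+ n)) 0              ≈⟨ ℚᵘ.*≡* (ℤ-distrib (ℤ.+ m) (ℤ.+ n)) ⟩
    ℚᵘ.mkℚᵘ (ℤ.+ m) 0 ℚᵘ.+ ℚᵘ.mkℚᵘ (ℤ.+ n) 0  ≈⟨ ℚᵘP.+-cong (embed m) (embed n) ⟩
    toℚᵘ (fromℕ m) ℚᵘ.+ toℚᵘ (fromℕ n)    ≈⟨ ℚP.toℚᵘ-homo-+ (fromℕ m) (fromℕ n) ⟨
    toℚᵘ (fromℕ m + fromℕ n)             ∎)
  where
  open ℚᵘP.≃-Reasoning
  embed : ∀ k → ℚᵘ.mkℚᵘ (ℤ.+ k) 0 ℚᵘ.≃ toℚᵘ (fromℕ k)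
  embed k = ℚᵘP.≃-sym (ℚP.toℚᵘ-fromℚᵘ (ℚᵘ.mkℚᵘ (ℤ.+ k) 0))
  ℤ-distrib : ∀ a b → (a ℤ.+ b) ℤ.* ℤ.+ 1 ≡ (a ℤ.* ℤ.+ 1 ℤ.+ b ℤ.* ℤ.+ 1) ℤ.* ℤ.+ 1
  ℤ-distrib a b rewrite ℤP.*-identityʳ (a ℤ.+ b) | ℤP.*-identityʳ a | ℤP.*-identityʳ b
    = sym (ℤP.*-identityʳ (a ℤ.+ b))

fromℕ-suc : ∀ n → fromℕ (suc n) ≡ 1ℚ + fromℕ n
fromℕ-suc n = fromℕ-+ 1 n

fromℕ-* : ∀ m n → fromℕ (m ℕ.* n) ≡ fromℕ m * fromℕ n
fromℕ-* zero    n = sym (ℚP.*-zeroˡ (fromℕ n))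
fromℕ-* (suc m) n = begin
  fromℕ (n ℕ.+ m ℕ.* n)          ≡⟨ fromℕ-+ n (m ℕ.* n) ⟩
  fromℕ n + fromℕ (m ℕ.* n)       ≡⟨ cong (fromℕ n +_) (fromℕ-* m n) ⟩
  fromℕ n + fromℕ m * fromℕ n     ≡⟨ solve 2 (λ a b → a :+ b :* a := (con 1ℚ :+ b) :* a) refl (fromℕ n) (fromℕ m) ⟩
  (1ℚ + fromℕ m) * fromℕ n        ≡⟨ cong (_* fromℕ n) (fromℕ-suc m) ⟨
  fromℕ (suc m) * fromℕ n         ∎
  where open ≡-Reasoning

fromℕ-∸ : ∀ {m n} → n ≤ m → fromℕ (m ∸ n) ≡ fromℕ m - fromℕ n
fromℕ-∸ {m} {n} n≤m = begin
  fromℕ (m ∸ n)                       ≡⟨ solve 2 (λ a b → a := (a :+ b) :- b) refl (fromℕ (m ∸ n)) (fromℕ n) ⟩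
  (fromℕ (m ∸ n) + fromℕ n) - fromℕ n ≡⟨ cong (_- fromℕ n) (fromℕ-+ (m ∸ n) n) ⟨
  fromℕ (m ∸ n ℕ.+ n) - fromℕ n       ≡⟨ cong (λ a → fromℕ a - fromℕ n) (ℕP.m∸n+n≡m n≤m) ⟩
  fromℕ m - fromℕ n                   ∎
  where open ≡-Reasoning

private variable A B : Set

sumL : (A → ℚ) → List A → ℚ
sumL g []       = 0ℚ
sumL g (a ∷ as) = g a + sumL g as

sumL-++ : (g : A → ℚ) (as bs : List A) → sumL g (as ++ bs) ≡ sumL g as + sumL g bs
sumL-++ g []       bs = sym (ℚP.+-identityˡ _)
sumL-++ g (a ∷ as) bs = trans (cong (g a +_) (sumL-++ g as bs)) (sym (ℚP.+-assoc (g a) _ _))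

sumL-cong : {g h : A → ℚ} → (∀ a → g a ≡ h a) → (as : List A) → sumL g as ≡ sumL h as
sumL-cong g≡h []       = refl
sumL-cong g≡h (a ∷ as) = cong₂ _+_ (g≡h a) (sumL-cong g≡h as)

sumL-+ : (g h : A → ℚ) (as : List A) → sumL (λ a → g a + h a) as ≡ sumL g as + sumL h as
sumL-+ g h []       = sym (ℚP.+-identityˡ 0ℚ)
sumL-+ g h (a ∷ as) = trans (cong (g a + h a +_) (sumL-+ g h as))
  (solve 4 (λ x y u v → (x :+ y) :+ (u :+ v) := (x :+ u) :+ (y :+ v)) refl (g a) (h a) (sumL g as) (sumL h as))

sumL-* : (r : ℚ) (g : A → ℚ) (as : List A) → sumL (λ a → r * g a) as ≡ r * sumL g as
sumL-* r g []       = sym (ℚP.*-zeroʳ r)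
sumL-* r g (a ∷ as) = trans (cong (r * g a +_) (sumL-* r g as)) (sym (ℚP.*-distribˡ-+ r (g a) _))

sumL-neg : (g : A → ℚ) (as : List A) → sumL (λ a → - g a) as ≡ - sumL g as
sumL-neg g []       = refl
sumL-neg g (a ∷ as) = trans (cong (- g a +_) (sumL-neg g as)) (sym (ℚP.neg-distrib-+ (g a) (sumL g as)))

sumL-zero : {g : A → ℚ} → (∀ a → g a ≡ 0ℚ) → (as : List A) → sumL g as ≡ 0ℚ
sumL-zero g≡0 []       = refl
sumL-zero g≡0 (a ∷ as) = trans (cong₂ _+_ (g≡0 a) (sumL-zero g≡0 as)) (ℚP.+-identityˡ 0ℚ)

sumL-map : (g : B → ℚ) (f : A → B) (as : List A) → sumL g (map f as) ≡ sumL (λ a → g (f a)) as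
sumL-map g f []       = refl
sumL-map g f (a ∷ as) = cong (g (f a) +_) (sumL-map g f as)

sumL-concatMap : (g : B → ℚ) (F : A → List B) (as : List A) →
                 sumL g (concatMap F as) ≡ sumL (λ a → sumL g (F a)) as
sumL-concatMap g F []       = refl
sumL-concatMap g F (a ∷ as) = trans (sumL-++ g (F a) (concatMap F as)) (cong (sumL g (F a) +_) (sumL-concatMap g F as))

sumL-upTo-suc : (g : ℕ → ℚ) (m : ℕ) → sumL g (upTo (suc m)) ≡ sumL g (upTo m) + g m
sumL-upTo-suc g m = begin
  sumL g (upTo (suc m))            ≡⟨ cong (sumL g) (upTo-∷ʳ m) ⟨
  sumL g (upTo m ++ m ∷ [])        ≡⟨ sumL-++ g (upTo m) (m ∷ []) ⟩
  sumL g (upTo m) + (g m + 0ℚ)     ≡⟨ cong (sumL g (upTo m) +_) (ℚP.+-identityʳ (g m)) ⟩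
  sumL g (upTo m) + g m            ∎
  where open ≡-Reasoning

sumL-upTo-shift : (g : ℕ → ℚ) (m : ℕ) → sumL g (applyUpTo suc m) ≡ sumL (λ a → g (suc a)) (upTo m)
sumL-upTo-shift g m = trans (cong (sumL g) (sym (map-applyUpTo (λ a → a) suc m))) (sumL-map g suc (upTo m))

sumL-cong-upTo : {g h : ℕ → ℚ} (m : ℕ) → (∀ a → a < m → g a ≡ h a) → sumL g (upTo m) ≡ sumL h (upTo m)
sumL-cong-upTo zero    g≡h = refl
sumL-cong-upTo {g} {h} (suc m) g≡h = begin
  sumL g (upTo (suc m))   ≡⟨ sumL-upTo-suc g m ⟩
  sumL g (upTo m) + g m   ≡⟨ cong₂ _+_ (sumL-cong-upTo m (λ a a<m → g≡h a (ℕP.m<n⇒m<1+n a<m))) (g≡h m (ℕP.n<1+n m)) ⟩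
  sumL h (upTo m) + h m   ≡⟨ sumL-upTo-suc h m ⟨
  sumL h (upTo (suc m))   ∎
  where open ≡-Reasoning

sumL-const-upTo : (r : ℚ) (m : ℕ) → sumL (λ _ → r) (upTo m) ≡ fromℕ m * r
sumL-const-upTo r zero    = sym (ℚP.*-zeroˡ r)
sumL-const-upTo r (suc m) = begin
  sumL (λ _ → r) (upTo (suc m))   ≡⟨ sumL-upTo-suc (λ _ → r) m ⟩
  sumL (λ _ → r) (upTo m) + r     ≡⟨ cong (_+ r) (sumL-const-upTo r m) ⟩
  fromℕ m * r + r                 ≡⟨ solve 2 (λ a x → a :* x :+ x := (con 1ℚ :+ a) :* x) refl (fromℕ m) r ⟩
  (1ℚ + fromℕ m) * r              ≡⟨ cong (_* r) (fromℕ-suc m) ⟨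
  fromℕ (suc m) * r               ∎
  where open ≡-Reasoning

sumL-filter : {P : A → Set} (P? : Decidable P) (G : A → ℚ) (as : List A) →
              sumL G (filter P? as) ≡ sumL (λ a → if does (P? a) then G a else 0ℚ) as
sumL-filter P? G []       = refl
sumL-filter P? G (a ∷ as) with does (P? a)
... | true  = cong (G a +_) (sumL-filter P? G as)
... | false = trans (sumL-filter P? G as) (sym (ℚP.+-identityˡ _))

sumL-shift : ∀ (h : ℕ → ℚ) m → h 0 ≡ 0ℚ → h m ≡ 0ℚ → sumL h (upTo m) ≡ sumL (λ j → h (suc j)) (upTo m)
sumL-shift h m h0≡0 hm≡0 = begin
  sumL h (upTo m)                             ≡⟨ ℚP.+-identityʳ _ ⟨
  sumL h (upTo m) + 0ℚ                        ≡⟨ cong (sumL h (upTo m) +_) hm≡0 ⟨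
  sumL h (upTo m) + h m                       ≡⟨ sumL-upTo-suc h m ⟨
  h 0 + sumL h (applyUpTo suc m)              ≡⟨ cong₂ _+_ h0≡0 (sumL-upTo-shift h m) ⟩
  0ℚ + sumL (λ j → h (suc j)) (upTo m)        ≡⟨ ℚP.+-identityˡ _ ⟩
  sumL (λ j → h (suc j)) (upTo m)             ∎
  where open ≡-Reasoning

-- Elements of h¹[t]
-- are combinations of monomials t^j·w and elements of ℚ[t] combinations
-- of exponents j, so both are handled by the same pairing.

⟪_∣_⟫ : (A → ℚ) → List (ℚ × A) → ℚ
⟪ φ ∣ xs ⟫ = sumL (λ t → proj₁ t * φ (proj₂ t)) xs

pair-++ : (φ : A → ℚ) (xs ys : List (ℚ × A)) → ⟪ φ ∣ xs ++ ys ⟫ ≡ ⟪ φ ∣ xs ⟫ + ⟪ φ ∣ ys ⟫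
pair-++ φ = sumL-++ _

pair-cong : {φ ψ : A → ℚ} → (∀ a → φ a ≡ ψ a) → (xs : List (ℚ × A)) → ⟪ φ ∣ xs ⟫ ≡ ⟪ ψ ∣ xs ⟫
pair-cong φ≡ψ = sumL-cong (λ t → cong (proj₁ t *_) (φ≡ψ (proj₂ t)))

pair-+ : (φ ψ : A → ℚ) (xs : List (ℚ × A)) → ⟪ (λ a → φ a + ψ a) ∣ xs ⟫ ≡ ⟪ φ ∣ xs ⟫ + ⟪ ψ ∣ xs ⟫
pair-+ φ ψ xs = trans (sumL-cong (λ t → ℚP.*-distribˡ-+ (proj₁ t) (φ (proj₂ t)) (ψ (proj₂ t))) xs) (sumL-+ _ _ xs)

pair-* : (r : ℚ) (φ : A → ℚ) (xs : List (ℚ × A)) → ⟪ (λ a → r * φ a) ∣ xs ⟫ ≡ r * ⟪ φ ∣ xs ⟫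
pair-* r φ xs = trans (sumL-cong (λ t → solve 3 (λ c r x → c :* (r :* x) := r :* (c :* x)) refl (proj₁ t) r (φ (proj₂ t))) xs)
                      (sumL-* r _ xs)

pair-zero : (xs : List (ℚ × A)) → ⟪ (λ _ → 0ℚ) ∣ xs ⟫ ≡ 0ℚ
pair-zero = sumL-zero (λ t → ℚP.*-zeroʳ (proj₁ t))

pair-concatMap : (φ : B → ℚ) (F : A → List (ℚ × B)) (as : List A) →
                 ⟪ φ ∣ concatMap F as ⟫ ≡ sumL (λ a → ⟪ φ ∣ F a ⟫) as
pair-concatMap φ = sumL-concatMap _

Monomial : Set
Monomial = ℕ × Word

indicator : ℕ → Word → Monomial → ℚ
indicator j w (i , v) = if (i ≡ᵇ j) ∧ (v ≟w w) then 1ℚ else 0ℚ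

coeff-pair : (f : H1t) (w : Word) (j : ℕ) → coeff f w j ≡ ⟪ indicator j w ∣ f ⟫
coeff-pair []                w j = refl
coeff-pair ((c , i , v) ∷ f) w j = step ((i ≡ᵇ j) ∧ (v ≟w w)) (coeff-pair f w j)
  where
  step : ∀ b {acc acc′} → acc ≡ acc′ → (if b then c + acc else acc) ≡ c * (if b then 1ℚ else 0ℚ) + acc′
  step true  refl = cong (_+ _) (sym (ℚP.*-identityʳ c))
  step false refl = sym (trans (cong (_+ _) (ℚP.*-zeroʳ c)) (ℚP.+-identityˡ _))

≈-from-pairings : (f g : H1t) → (∀ φ → ⟪ φ ∣ f ⟫ ≡ ⟪ φ ∣ g ⟫) → f ≈ g
≈-from-pairings f g same w j = trans (coeff-pair f w j) (trans (same (indicator j w)) (sym (coeff-pair g w j)))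

-- Adjoints of the operations of Defs: each operation O on h¹[t] (or ℚ[t])
-- satisfies ⟪ φ ∣ O f ⟫ ≡ ⟪ Oᵀ φ ∣ f ⟫ for an explicit weight Oᵀ φ.

-- multiplication by t^i
raise : ℕ → (Monomial → ℚ) → Monomial → ℚ
raise i φ (j , v) = φ (i ℕ.+ j , v)

zconsᵀ : ℕ → (Monomial → ℚ) → Monomial → ℚ
zconsᵀ a φ (j , v) = φ (j , a ∷ v)

circᵀ : ℕ → (Monomial → ℚ) → Monomial → ℚ
circᵀ a φ (j , [])    = 0ℚ
circᵀ a φ (j , b ∷ v) = φ (j , (a ℕ.+ b) ∷ v)

ddtᵀ : (Monomial → ℚ) → Monomial → ℚ
ddtᵀ φ (j , v) = fromℕ j * φ (j ∸ 1 , v)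

ddtQᵀ : (ℕ → ℚ) → ℕ → ℚ
ddtQᵀ ψ j = fromℕ j * ψ (j ∸ 1)

pair-zcons : ∀ a φ f → ⟪ φ ∣ zcons a f ⟫ ≡ ⟪ zconsᵀ a φ ∣ f ⟫
pair-zcons a φ []                = refl
pair-zcons a φ ((c , j , v) ∷ f) = cong (c * φ (j , a ∷ v) +_) (pair-zcons a φ f)

pair-timesT : ∀ φ f → ⟪ φ ∣ timesT f ⟫ ≡ ⟪ raise 1 φ ∣ f ⟫
pair-timesT φ []                = refl
pair-timesT φ ((c , j , v) ∷ f) = cong (c * φ (suc j , v) +_) (pair-timesT φ f)

pair-circ : ∀ a φ f → ⟪ φ ∣ circ a f ⟫ ≡ ⟪ circᵀ a φ ∣ f ⟫
pair-circ a φ []                    = refl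
pair-circ a φ ((c , j , []) ∷ f)    = trans (pair-circ a φ f)
  (sym (trans (cong (_+ ⟪ circᵀ a φ ∣ f ⟫) (ℚP.*-zeroʳ c)) (ℚP.+-identityˡ _)))
pair-circ a φ ((c , j , b ∷ v) ∷ f) = cong (c * φ (j , (a ℕ.+ b) ∷ v) +_) (pair-circ a φ f)

pair-ddt : ∀ φ f → ⟪ φ ∣ ddt f ⟫ ≡ ⟪ ddtᵀ φ ∣ f ⟫
pair-ddt φ []                = refl
pair-ddt φ ((c , j , v) ∷ f) = cong₂ _+_ (ℚP.*-assoc c (fromℕ j) _) (pair-ddt φ f)

pair-·-term : ∀ a i φ g → ⟪ φ ∣ ((a , i) ∷ []) · g ⟫ ≡ a * ⟪ raise i φ ∣ g ⟫
pair-·-term a i φ []                = sym (ℚP.*-zeroʳ a)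
pair-·-term a i φ ((c , j , w) ∷ g) = trans (cong (a * c * φ (i ℕ.+ j , w) +_) (pair-·-term a i φ g))
  (solve 4 (λ a c x e → a :* c :* x :+ a :* e := a :* (c :* x :+ e)) refl a c (φ (i ℕ.+ j , w)) ⟪ raise i φ ∣ g ⟫)

pair-· : ∀ φ p g → ⟪ φ ∣ p · g ⟫ ≡ ⟪ (λ i → ⟪ raise i φ ∣ g ⟫) ∣ p ⟫
pair-· φ []            g = refl
pair-· φ ((a , i) ∷ p) g = trans (pair-++ φ (map _ g) (p · g))
  (cong₂ _+_ (trans (cong ⟪ φ ∣_⟫ (sym (++-identityʳ (map _ g)))) (pair-·-term a i φ g)) (pair-· φ p g))

Stᵀ : (Monomial → ℚ) → Monomial → ℚ
Stᵀ φ (j , w) = ⟪ raise j φ ∣ Stw w ⟫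

pair-St : ∀ φ f → ⟪ φ ∣ St f ⟫ ≡ ⟪ Stᵀ φ ∣ f ⟫
pair-St φ []                = refl
pair-St φ ((c , j , w) ∷ f) = trans (pair-++ φ (((c , j) ∷ []) · Stw w) (St f))
  (cong₂ _+_ (pair-·-term c j φ (Stw w)) (pair-St φ f))

pair-*QT-term : ∀ a i ψ q → ⟪ ψ ∣ ((a , i) ∷ []) *QT q ⟫ ≡ a * ⟪ (λ j → ψ (i ℕ.+ j)) ∣ q ⟫
pair-*QT-term a i ψ []            = sym (ℚP.*-zeroʳ a)
pair-*QT-term a i ψ ((b , j) ∷ q) = trans (cong (a * b * ψ (i ℕ.+ j) +_) (pair-*QT-term a i ψ q))
  (solve 4 (λ a c x e → a :* c :* x :+ a :* e := a :* (c :* x :+ e)) refl a b (ψ (i ℕ.+ j)) ⟪ (λ j → ψ (i ℕ.+ j)) ∣ q ⟫)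

pair-*QT : ∀ ψ p q → ⟪ ψ ∣ p *QT q ⟫ ≡ ⟪ (λ i → ⟪ (λ j → ψ (i ℕ.+ j)) ∣ q ⟫) ∣ p ⟫
pair-*QT ψ []            q = refl
pair-*QT ψ ((a , i) ∷ p) q = trans (pair-++ ψ (map _ q) (p *QT q))
  (cong₂ _+_ (trans (cong ⟪ ψ ∣_⟫ (sym (++-identityʳ (map _ q)))) (pair-*QT-term a i ψ q)) (pair-*QT ψ p q))

-- Derivative of S^t on a word:  d/dt S^t(w) = Σ_v S^t(v), summed over the
-- contractions v of w, i.e. the words obtained from w by merging one pair
-- of adjacent letters z_a z_b into z_{a+b}.

headMerge : ℕ → Word → List Word
headMerge a []      = []
headMerge a (b ∷ w) = ((a ℕ.+ b) ∷ w) ∷ []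

contractions : Word → List Word
contractions []      = []
contractions (a ∷ w) = headMerge a w ++ map (a ∷_) (contractions w)

onSt : (Monomial → ℚ) → Word → ℚ
onSt φ w = ⟪ φ ∣ Stw w ⟫

onSt-cons : ∀ a w φ → onSt φ (a ∷ w) ≡ onSt (zconsᵀ a φ) w + onSt (circᵀ a (raise 1 φ)) w
onSt-cons a w φ = trans (pair-++ φ (zcons a (Stw w)) (timesT (circ a (Stw w))))
  (cong₂ _+_ (pair-zcons a φ (Stw w)) (trans (pair-timesT φ (circ a (Stw w))) (pair-circ a (raise 1 φ) (Stw w))))

-- z_a ∘ S^t(z_b w) = S^t(z_{a+b} w), because z_a ∘ z_b ∘ u = z_{a+b} ∘ u
circ-onSt : ∀ a b w φ → onSt (circᵀ a φ) (b ∷ w) ≡ onSt φ ((a ℕ.+ b) ∷ w)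
circ-onSt a b w φ = begin
  onSt (circᵀ a φ) (b ∷ w)
    ≡⟨ onSt-cons b w (circᵀ a φ) ⟩
  onSt (zconsᵀ (a ℕ.+ b) φ) w + onSt (circᵀ b (raise 1 (circᵀ a φ))) w
    ≡⟨ cong (onSt (zconsᵀ (a ℕ.+ b) φ) w +_) (pair-cong circ-circ (Stw w)) ⟩
  onSt (zconsᵀ (a ℕ.+ b) φ) w + onSt (circᵀ (a ℕ.+ b) (raise 1 φ)) w
    ≡⟨ onSt-cons (a ℕ.+ b) w φ ⟨
  onSt φ ((a ℕ.+ b) ∷ w) ∎
  where
  open ≡-Reasoning
  circ-circ : ∀ m → circᵀ b (raise 1 (circᵀ a φ)) m ≡ circᵀ (a ℕ.+ b) (raise 1 φ) m
  circ-circ (j , [])    = refl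
  circ-circ (j , c ∷ v) = cong (λ d → φ (suc j , d ∷ v)) (sym (ℕP.+-assoc a b c))

circ-onSt-headMerge : ∀ a w φ → onSt (circᵀ a φ) w ≡ sumL (onSt φ) (headMerge a w)
circ-onSt-headMerge a []      φ = solve 0 (con 1ℚ :* con 0ℚ :+ con 0ℚ := con 0ℚ) refl
circ-onSt-headMerge a (b ∷ w) φ = trans (circ-onSt a b w φ) (sym (ℚP.+-identityʳ _))

-- product rule for d/dt (t·u) = u + t·du/dt, composed with z_a ∘ (−)
circ-raise-ddt : ∀ a φ m → circᵀ a (raise 1 (ddtᵀ φ)) m ≡ circᵀ a φ m + ddtᵀ (circᵀ a (raise 1 φ)) m
circ-raise-ddt a φ (j , [])    = solve 1 (λ n → con 0ℚ := con 0ℚ :+ n :* con 0ℚ) refl (fromℕ j)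
circ-raise-ddt a φ (zero , b ∷ v) =
  solve 2 (λ x y → con 1ℚ :* x := x :+ con 0ℚ :* y) refl (φ (0 , (a ℕ.+ b) ∷ v)) (φ (1 , (a ℕ.+ b) ∷ v))
circ-raise-ddt a φ (suc j , b ∷ v) = begin
  fromℕ (suc (suc j)) * y             ≡⟨ cong (_* y) (fromℕ-suc (suc j)) ⟩
  (1ℚ + fromℕ (suc j)) * y            ≡⟨ solve 2 (λ n x → (con 1ℚ :+ n) :* x := x :+ n :* x) refl (fromℕ (suc j)) y ⟩
  y + fromℕ (suc j) * y               ∎
  where open ≡-Reasoning
        y : ℚ
        y = φ (suc j , (a ℕ.+ b) ∷ v)

ddt-onSt : ∀ w φ → onSt (ddtᵀ φ) w ≡ sumL (onSt φ) (contractions w)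
ddt-onSt []      φ = solve 1 (λ x → con 1ℚ :* (con 0ℚ :* x) :+ con 0ℚ := con 0ℚ) refl (φ (0 , []))
ddt-onSt (a ∷ w) φ = begin
  onSt (ddtᵀ φ) (a ∷ w)
    ≡⟨ onSt-cons a w (ddtᵀ φ) ⟩
  onSt (ddtᵀ (zconsᵀ a φ)) w + onSt (circᵀ a (raise 1 (ddtᵀ φ))) w
    ≡⟨ cong₂ _+_ (ddt-onSt w (zconsᵀ a φ))
                 (trans (pair-cong (circ-raise-ddt a φ) (Stw w)) (pair-+ (circᵀ a φ) _ (Stw w))) ⟩
  sumL zPart (contractions w) + (onSt (circᵀ a φ) w + onSt (ddtᵀ (circᵀ a (raise 1 φ))) w)
    ≡⟨ cong (λ x → sumL zPart (contractions w) + (x + onSt (ddtᵀ (circᵀ a (raise 1 φ))) w))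
            (circ-onSt-headMerge a w φ) ⟩
  sumL zPart (contractions w) + (sumL (onSt φ) (headMerge a w) + onSt (ddtᵀ (circᵀ a (raise 1 φ))) w)
    ≡⟨ cong (λ x → sumL zPart (contractions w) + (sumL (onSt φ) (headMerge a w) + x))
            (ddt-onSt w (circᵀ a (raise 1 φ))) ⟩
  sumL zPart (contractions w) + (sumL (onSt φ) (headMerge a w) + sumL tPart (contractions w))
    ≡⟨ solve 3 (λ z h t → z :+ (h :+ t) := h :+ (z :+ t)) refl
             (sumL zPart (contractions w)) (sumL (onSt φ) (headMerge a w)) (sumL tPart (contractions w)) ⟩
  sumL (onSt φ) (headMerge a w) + (sumL zPart (contractions w) + sumL tPart (contractions w))
    ≡⟨ cong (sumL (onSt φ) (headMerge a w) +_) (sym (sumL-+ zPart tPart (contractions w))) ⟩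
  sumL (onSt φ) (headMerge a w) + sumL (λ v → zPart v + tPart v) (contractions w)
    ≡⟨ cong (sumL (onSt φ) (headMerge a w) +_) (sumL-cong (λ v → sym (onSt-cons a v φ)) (contractions w)) ⟩
  sumL (onSt φ) (headMerge a w) + sumL (λ v → onSt φ (a ∷ v)) (contractions w)
    ≡⟨ cong (sumL (onSt φ) (headMerge a w) +_) (sym (sumL-map (onSt φ) (a ∷_) (contractions w))) ⟩
  sumL (onSt φ) (headMerge a w) + sumL (onSt φ) (map (a ∷_) (contractions w))
    ≡⟨ sumL-++ (onSt φ) (headMerge a w) _ ⟨
  sumL (onSt φ) (contractions (a ∷ w)) ∎
  where
  open ≡-Reasoning
  zPart tPart : Word → ℚ
  zPart = onSt (zconsᵀ a φ)
  tPart = onSt (circᵀ a (raise 1 φ))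

-- Every composition v of m into n positive
-- parts arises as a contraction of exactly m − n compositions of m into
-- n + 1 parts (a part c of v splits into two positive parts in c − 1 ways),
-- so summing any g over all contractions of all w ∈ comps (n + 1) m gives
-- (m − n) · Σ_{v ∈ comps n m} g(v).  When the first part must exceed 1,
-- as in x_{k,n}, the first part splits in one way fewer and the factor
-- becomes m − n − 1.  Both are proved by induction on n, splitting off
-- the first part.

contractSum : (Word → ℚ) → Word → ℚ
contractSum g w = sumL g (contractions w)

contractSum-cons : ∀ g c w → contractSum g (c ∷ w) ≡ sumL g (headMerge c w) + contractSum (λ v → g (c ∷ v)) w
contractSum-cons g c w = trans (sumL-++ g (headMerge c w) _)
  (cong (sumL g (headMerge c w) +_) (sumL-map g (c ∷_) (contractions w)))

comps-suc : ∀ g n m → sumL g (comps (suc n) m)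
                    ≡ sumL (λ a → sumL (λ w → g (suc a ∷ w)) (comps n (m ∸ suc a))) (upTo m)
comps-suc g n m = begin
  sumL g (comps (suc n) m)
    ≡⟨ sumL-concatMap g _ (map suc (upTo m)) ⟩
  sumL (λ a → sumL g (map (a ∷_) (comps n (m ∸ a)))) (map suc (upTo m))
    ≡⟨ sumL-map _ suc (upTo m) ⟩
  sumL (λ a → sumL g (map (suc a ∷_) (comps n (m ∸ suc a)))) (upTo m)
    ≡⟨ sumL-cong (λ a → sumL-map g (suc a ∷_) (comps n (m ∸ suc a))) (upTo m) ⟩
  sumL (λ a → sumL (λ w → g (suc a ∷ w)) (comps n (m ∸ suc a))) (upTo m) ∎
  where open ≡-Reasoning

comps-zero : ∀ G r → G [] ≡ 0ℚ → sumL G (comps 0 r) ≡ 0ℚ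
comps-zero G zero    G[]≡0 = trans (cong (_+ 0ℚ) G[]≡0) (ℚP.+-identityʳ 0ℚ)
comps-zero G (suc r) G[]≡0 = refl

triangle : ∀ (F : ℕ → ℚ) m → sumL (λ a → sumL (λ b → F (suc a ℕ.+ suc b)) (upTo (m ∸ suc a))) (upTo m)
                           ≡ sumL (λ c → fromℕ c * F (suc c)) (upTo m)
triangle F zero    = refl
triangle F (suc m) = begin
  sumL inner (upTo (suc m))
    ≡⟨ sumL-upTo-suc inner m ⟩
  sumL inner (upTo m) + inner m
    ≡⟨ cong₂ _+_ (sumL-cong-upTo m peel) (cong (λ r → sumL (λ b → F (suc m ℕ.+ suc b)) (upTo r)) (ℕP.n∸n≡0 m)) ⟩
  sumL (λ a → inner′ a + F (suc m)) (upTo m) + 0ℚ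
    ≡⟨ ℚP.+-identityʳ _ ⟩
  sumL (λ a → inner′ a + F (suc m)) (upTo m)
    ≡⟨ sumL-+ inner′ (λ _ → F (suc m)) (upTo m) ⟩
  sumL inner′ (upTo m) + sumL (λ _ → F (suc m)) (upTo m)
    ≡⟨ cong₂ _+_ (triangle F m) (sumL-const-upTo (F (suc m)) m) ⟩
  sumL (λ c → fromℕ c * F (suc c)) (upTo m) + fromℕ m * F (suc m)
    ≡⟨ sumL-upTo-suc (λ c → fromℕ c * F (suc c)) m ⟨
  sumL (λ c → fromℕ c * F (suc c)) (upTo (suc m)) ∎
  where
  open ≡-Reasoning
  inner inner′ : ℕ → ℚ
  inner  a = sumL (λ b → F (suc a ℕ.+ suc b)) (upTo (m ∸ a))
  inner′ a = sumL (λ b → F (suc a ℕ.+ suc b)) (upTo (m ∸ suc a))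
  peel : ∀ a → a < m → inner a ≡ inner′ a + F (suc m)
  peel a a<m = begin
    inner a
      ≡⟨ cong (λ r → sumL (λ b → F (suc a ℕ.+ suc b)) (upTo r)) (ℕP.+-∸-assoc 1 a<m) ⟩
    sumL (λ b → F (suc a ℕ.+ suc b)) (upTo (suc (m ∸ suc a)))
      ≡⟨ sumL-upTo-suc (λ b → F (suc a ℕ.+ suc b)) (m ∸ suc a) ⟩
    inner′ a + F (suc a ℕ.+ suc (m ∸ suc a))
      ≡⟨ cong (λ c → inner′ a + F c) (trans (ℕP.+-suc (suc a) (m ∸ suc a)) (cong suc (ℕP.m+[n∸m]≡n a<m))) ⟩
    inner′ a + F (suc m) ∎

headMerge-comps : ∀ g c n r → sumL (λ w → sumL g (headMerge c w)) (comps (suc n) r)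
                            ≡ sumL (λ b → sumL (λ w → g ((c ℕ.+ suc b) ∷ w)) (comps n (r ∸ suc b))) (upTo r)
headMerge-comps g c n r = trans (comps-suc _ n r)
  (sumL-cong (λ b → sumL-cong (λ w → ℚP.+-identityʳ (g ((c ℕ.+ suc b) ∷ w))) (comps n (r ∸ suc b))) (upTo r))

ContractCount : ℕ → Set
ContractCount n = ∀ m g → sumL (contractSum g) (comps (suc n) m) ≡ (fromℕ m - fromℕ n) * sumL g (comps n m)

-- The inductive step, for the compositions of s + m whose first part is
-- s + 1 + a with a < m: contractions inside the tail are counted by the
-- induction hypothesis, merges into the first part by `triangle`.
module _ (s n m : ℕ) (g : Word → ℚ) (IH : ContractCount n) where

  headed : ℕ → ℚ
  headed j = sumL (λ w → g ((s ℕ.+ j) ∷ w)) (comps n (m ∸ j))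

  private
    merged tail : ℕ → ℚ
    merged a = sumL (λ b → headed (suc a ℕ.+ suc b)) (upTo (m ∸ suc a))
    tail   a = (fromℕ (m ∸ suc a) - fromℕ n) * headed (suc a)

  contract-first : ∀ a → sumL (λ w → contractSum g ((s ℕ.+ suc a) ∷ w)) (comps (suc n) (m ∸ suc a))
                       ≡ merged a + tail a
  contract-first a = begin
    sumL (λ w → contractSum g (c ∷ w)) (comps (suc n) r)
      ≡⟨ sumL-cong (contractSum-cons g c) (comps (suc n) r) ⟩
    sumL (λ w → sumL g (headMerge c w) + contractSum (λ v → g (c ∷ v)) w) (comps (suc n) r)
      ≡⟨ sumL-+ _ _ (comps (suc n) r) ⟩
    sumL (λ w → sumL g (headMerge c w)) (comps (suc n) r) + sumL (contractSum (λ v → g (c ∷ v))) (comps (suc n) r)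
      ≡⟨ cong₂ _+_ (trans (headMerge-comps g c n r) (sumL-cong reassociate (upTo r))) (IH r (λ v → g (c ∷ v))) ⟩
    merged a + tail a ∎
    where
    open ≡-Reasoning
    c r : ℕ
    c = s ℕ.+ suc a
    r = m ∸ suc a
    reassociate : ∀ b → sumL (λ w → g ((c ℕ.+ suc b) ∷ w)) (comps n (r ∸ suc b)) ≡ headed (suc a ℕ.+ suc b)
    reassociate b = cong₂ (λ d r → sumL (λ w → g (d ∷ w)) (comps n r))
                          (ℕP.+-assoc s (suc a) (suc b)) (ℕP.∸-+-assoc m (suc a) (suc b))

  -- a part c of a word counted by `headed` has (c − 1) + (m − c − n) = m − (n + 1) splittings
  count-splittings : ∀ c → c < m → fromℕ c * headed (suc c) + tail c ≡ (fromℕ m - fromℕ (suc n)) * headed (suc c)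
  count-splittings c c<m = begin
    fromℕ c * y + (fromℕ (m ∸ suc c) - fromℕ n) * y
      ≡⟨ cong (λ z → fromℕ c * y + (z - fromℕ n) * y) (trans (fromℕ-∸ c<m) (cong (λ z → fromℕ m - z) (fromℕ-suc c))) ⟩
    fromℕ c * y + (fromℕ m - (1ℚ + fromℕ c) - fromℕ n) * y
      ≡⟨ solve 4 (λ c m n y → c :* y :+ (m :- (con 1ℚ :+ c) :- n) :* y := (m :- (con 1ℚ :+ n)) :* y)
               refl (fromℕ c) (fromℕ m) (fromℕ n) y ⟩
    (fromℕ m - (1ℚ + fromℕ n)) * y
      ≡⟨ cong (λ z → (fromℕ m - z) * y) (fromℕ-suc n) ⟨
    (fromℕ m - fromℕ (suc n)) * y ∎
    where
    open ≡-Reasoning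
    y : ℚ
    y = headed (suc c)

  contract-headed : sumL (λ a → sumL (λ w → contractSum g ((s ℕ.+ suc a) ∷ w)) (comps (suc n) (m ∸ suc a))) (upTo m)
                  ≡ (fromℕ m - fromℕ (suc n)) * sumL (λ a → headed (suc a)) (upTo m)
  contract-headed = begin
    sumL (λ a → sumL (λ w → contractSum g ((s ℕ.+ suc a) ∷ w)) (comps (suc n) (m ∸ suc a))) (upTo m)
      ≡⟨ sumL-cong contract-first (upTo m) ⟩
    sumL (λ a → merged a + tail a) (upTo m)
      ≡⟨ sumL-+ merged tail (upTo m) ⟩
    sumL merged (upTo m) + sumL tail (upTo m)
      ≡⟨ cong (_+ sumL tail (upTo m)) (triangle headed m) ⟩
    sumL (λ c → fromℕ c * headed (suc c)) (upTo m) + sumL tail (upTo m)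
      ≡⟨ sumL-+ (λ c → fromℕ c * headed (suc c)) tail (upTo m) ⟨
    sumL (λ c → fromℕ c * headed (suc c) + tail c) (upTo m)
      ≡⟨ sumL-cong-upTo m count-splittings ⟩
    sumL (λ c → (fromℕ m - fromℕ (suc n)) * headed (suc c)) (upTo m)
      ≡⟨ sumL-* (fromℕ m - fromℕ (suc n)) (λ c → headed (suc c)) (upTo m) ⟩
    (fromℕ m - fromℕ (suc n)) * sumL (λ a → headed (suc a)) (upTo m) ∎
    where open ≡-Reasoning

contract-comps : ∀ n → ContractCount n
contract-comps zero m g = trans no-contractions (sym (empty-or-factor m))
  where
  no-contractions : sumL (contractSum g) (comps 1 m) ≡ 0ℚ
  no-contractions = trans (comps-suc (contractSum g) 0 m)
    (sumL-zero (λ a → comps-zero (λ w → contractSum g (suc a ∷ w)) (m ∸ suc a) refl) (upTo m))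
  empty-or-factor : ∀ m → (fromℕ m - fromℕ 0) * sumL g (comps 0 m) ≡ 0ℚ
  empty-or-factor zero    = trans (cong (_* sumL g (comps 0 0)) (ℚP.+-inverseʳ 0ℚ)) (ℚP.*-zeroˡ (sumL g (comps 0 0)))
  empty-or-factor (suc m) = ℚP.*-zeroʳ (fromℕ (suc m) - fromℕ 0)
contract-comps (suc n) m g = begin
  sumL (contractSum g) (comps (suc (suc n)) m)
    ≡⟨ comps-suc (contractSum g) (suc n) m ⟩
  sumL (λ a → sumL (λ w → contractSum g (suc a ∷ w)) (comps (suc n) (m ∸ suc a))) (upTo m)
    ≡⟨ contract-headed 0 n m g (contract-comps n) ⟩
  (fromℕ m - fromℕ (suc n)) * sumL (λ a → sumL (λ w → g (suc a ∷ w)) (comps n (m ∸ suc a))) (upTo m)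
    ≡⟨ cong ((fromℕ m - fromℕ (suc n)) *_) (comps-suc g n m) ⟨
  (fromℕ m - fromℕ (suc n)) * sumL g (comps (suc n) m) ∎
  where open ≡-Reasoning

xWords : ℕ → ℕ → List Word
xWords k n = filter (λ w → headGe2 w Bool.≟ true) (comps n k)

xWords-suc : ∀ G k′ n → sumL G (xWords (suc k′) (suc n))
                      ≡ sumL (λ a → sumL (λ w → G (suc (suc a) ∷ w)) (comps n (k′ ∸ suc a))) (upTo k′)
xWords-suc G k′ n = begin
  sumL G (xWords (suc k′) (suc n))
    ≡⟨ sumL-filter (λ w → headGe2 w Bool.≟ true) G (comps (suc n) (suc k′)) ⟩
  sumL G₂ (comps (suc n) (suc k′))
    ≡⟨ comps-suc G₂ n (suc k′) ⟩
  sumL (λ w → G₂ (1 ∷ w)) (comps n k′) + sumL (λ a → sumL (λ w → G₂ (suc a ∷ w)) (comps n (k′ ∸ a))) (applyUpTo suc k′)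
    ≡⟨ cong₂ _+_ (sumL-zero (λ w → refl) (comps n k′)) (sumL-upTo-shift _ k′) ⟩
  0ℚ + sumL (λ a → sumL (λ w → G (suc (suc a) ∷ w)) (comps n (k′ ∸ suc a))) (upTo k′)
    ≡⟨ ℚP.+-identityˡ _ ⟩
  sumL (λ a → sumL (λ w → G (suc (suc a) ∷ w)) (comps n (k′ ∸ suc a))) (upTo k′) ∎
  where
  open ≡-Reasoning
  G₂ : Word → ℚ
  G₂ w = if does (headGe2 w Bool.≟ true) then G w else 0ℚ

contract-xWords : ∀ k′ n g → sumL (contractSum g) (xWords (suc k′) (suc n))
                           ≡ (fromℕ (suc k′) - fromℕ (suc n)) * sumL g (xWords (suc k′) n)
contract-xWords k′ zero g = begin
  sumL (contractSum g) (xWords (suc k′) 1)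
    ≡⟨ xWords-suc (contractSum g) k′ 0 ⟩
  sumL (λ a → sumL (λ w → contractSum g (suc (suc a) ∷ w)) (comps 0 (k′ ∸ suc a))) (upTo k′)
    ≡⟨ sumL-zero (λ a → comps-zero _ (k′ ∸ suc a) refl) (upTo k′) ⟩
  0ℚ
    ≡⟨ ℚP.*-zeroʳ (fromℕ (suc k′) - fromℕ 1) ⟨
  (fromℕ (suc k′) - fromℕ 1) * 0ℚ ∎
  where open ≡-Reasoning
contract-xWords k′ (suc n) g = begin
  sumL (contractSum g) (xWords (suc k′) (suc (suc n)))
    ≡⟨ xWords-suc (contractSum g) k′ (suc n) ⟩
  sumL (λ a → sumL (λ w → contractSum g (suc (suc a) ∷ w)) (comps (suc n) (k′ ∸ suc a))) (upTo k′)
    ≡⟨ contract-headed 1 n k′ g (contract-comps n) ⟩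
  (fromℕ k′ - fromℕ (suc n)) * sumL (λ a → sumL (λ w → g (suc (suc a) ∷ w)) (comps n (k′ ∸ suc a))) (upTo k′)
    ≡⟨ cong₂ _*_ shift (sym (xWords-suc g k′ n)) ⟩
  (fromℕ (suc k′) - fromℕ (suc (suc n))) * sumL g (xWords (suc k′) (suc n)) ∎
  where
  open ≡-Reasoning
  shift : fromℕ k′ - fromℕ (suc n) ≡ fromℕ (suc k′) - fromℕ (suc (suc n))
  shift = begin
    fromℕ k′ - fromℕ (suc n)
      ≡⟨ solve 2 (λ k n → k :- n := (con 1ℚ :+ k) :- (con 1ℚ :+ n)) refl (fromℕ k′) (fromℕ (suc n)) ⟩
    (1ℚ + fromℕ k′) - (1ℚ + fromℕ (suc n))
      ≡⟨ cong₂ _-_ (fromℕ-suc k′) (fromℕ-suc (suc n)) ⟨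
    fromℕ (suc k′) - fromℕ (suc (suc n)) ∎

-- They satisfy P_{k,n+1} = (1 − t) P_{k,n} + C(k−1,n) t^n, and the claim
-- follows by induction on n from the absorption identity
-- (n + 1) C(k−1,n+1) = (k − 1 − n) C(k−1,n).

binom : ℕ → ℕ → ℚ
binom k j = fromℕ ((k ∸ 1) C j)

onPow : ℕ → (ℕ → ℚ) → ℚ
onPow m ψ = ⟪ ψ ∣ powQT oneMinusT m ⟫

onPow-zero : ∀ ψ → onPow 0 ψ ≡ ψ 0
onPow-zero ψ = solve 1 (λ y → con 1ℚ :* y :+ con 0ℚ := y) refl (ψ 0)

onPow-suc : ∀ m ψ → onPow (suc m) ψ ≡ onPow m ψ - onPow m (λ l → ψ (suc l))
onPow-suc m ψ = trans (pair-*QT ψ oneMinusT (powQT oneMinusT m))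
  (solve 2 (λ a b → con 1ℚ :* a :+ (con (- 1ℚ) :* b :+ con 0ℚ) := a :- b) refl (onPow m ψ) (onPow m (λ l → ψ (suc l))))

onP : ∀ k n ψ → ⟪ ψ ∣ P k n ⟫ ≡ sumL (λ j → binom k j * onPow (n ∸ 1 ∸ j) (λ l → ψ (j ℕ.+ l))) (upTo n)
onP k n ψ = trans (pair-concatMap ψ _ (upTo n))
  (sumL-cong (λ j → pair-*QT-term (binom k j) j ψ (powQT oneMinusT (n ∸ 1 ∸ j))) (upTo n))

onP-suc : ∀ k n ψ → ⟪ ψ ∣ P k (suc n) ⟫ ≡ ⟪ ψ ∣ P k n ⟫ - ⟪ (λ l → ψ (suc l)) ∣ P k n ⟫ + binom k n * ψ n
onP-suc k n ψ = begin
  ⟪ ψ ∣ P k (suc n) ⟫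
    ≡⟨ onP k (suc n) ψ ⟩
  sumL (λ j → term j (n ∸ j)) (upTo (suc n))
    ≡⟨ sumL-upTo-suc (λ j → term j (n ∸ j)) n ⟩
  sumL (λ j → term j (n ∸ j)) (upTo n) + term n (n ∸ n)
    ≡⟨ cong₂ _+_ (sumL-cong-upTo n (λ j j<n → trans (cong (term j) (range j j<n)) (split j)))
                 (cong (term n) (ℕP.n∸n≡0 n)) ⟩
  sumL (λ j → term j (n ∸ 1 ∸ j) + - termₛ j) (upTo n) + binom k n * onPow 0 (λ l → ψ (n ℕ.+ l))
    ≡⟨ cong₂ _+_ (trans (sumL-+ _ _ (upTo n)) (cong₂ _+_ (sym (onP k n ψ))
                                                (trans (sumL-neg termₛ (upTo n)) (cong -_ (sym (onP k n (λ l → ψ (suc l))))))))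
                 (cong (binom k n *_) (trans (onPow-zero (λ l → ψ (n ℕ.+ l))) (cong ψ (ℕP.+-identityʳ n)))) ⟩
  ⟪ ψ ∣ P k n ⟫ - ⟪ (λ l → ψ (suc l)) ∣ P k n ⟫ + binom k n * ψ n ∎
  where
  open ≡-Reasoning
  term : ℕ → ℕ → ℚ
  term j m = binom k j * onPow m (λ l → ψ (j ℕ.+ l))
  termₛ : ℕ → ℚ
  termₛ j = binom k j * onPow (n ∸ 1 ∸ j) (λ l → ψ (suc (j ℕ.+ l)))
  range : ∀ j → j < n → n ∸ j ≡ suc (n ∸ 1 ∸ j)
  range j j<n = trans (ℕP.+-∸-assoc 1 j<n) (cong suc (sym (ℕP.∸-+-assoc n 1 j)))
  split : ∀ j → term j (suc (n ∸ 1 ∸ j)) ≡ term j (n ∸ 1 ∸ j) + - termₛ j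
  split j = trans (cong (binom k j *_) (trans (onPow-suc (n ∸ 1 ∸ j) (λ l → ψ (j ℕ.+ l)))
                    (cong (λ y → onPow (n ∸ 1 ∸ j) (λ l → ψ (j ℕ.+ l)) - y)
                          (pair-cong (λ l → cong ψ (ℕP.+-suc j l)) (powQT oneMinusT (n ∸ 1 ∸ j))))))
                  (solve 3 (λ c a b → c :* (a :- b) := c :* a :+ (:- (c :* b))) refl
                         (binom k j) (onPow (n ∸ 1 ∸ j) (λ l → ψ (j ℕ.+ l))) (onPow (n ∸ 1 ∸ j) (λ l → ψ (suc (j ℕ.+ l)))))

absorption : ∀ N j → suc j ℕ.* (N C suc j) ℕ.+ j ℕ.* (N C j) ≡ N ℕ.* (N C j)
absorption zero    zero    = refl
absorption zero    (suc j) rewrite ℕP.*-zeroʳ j = refl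
absorption (suc N) zero    = begin
  1 ℕ.* (suc N C 1) ℕ.+ 0  ≡⟨ cong (λ x → x ℕ.+ 0 ℕ.+ 0) (nC1≡n (suc N)) ⟩
  suc N ℕ.+ 0 ℕ.+ 0        ≡⟨ solveℕ 1 (λ n → n ⊕ conℕ 0 ⊕ conℕ 0 ≐ n ⊛ conℕ 1) refl (suc N) ⟩
  suc N ℕ.* 1              ∎
  where open ≡-Reasoning
absorption (suc N) (suc j) = begin
  suc (suc j) ℕ.* (suc N C suc (suc j)) ℕ.+ suc j ℕ.* (suc N C suc j)
    ≡⟨ cong₂ (λ a b → suc (suc j) ℕ.* a ℕ.+ suc j ℕ.* b) (sym (nCk+nC[k+1]≡[n+1]C[k+1] N (suc j)))
                                                         (sym (nCk+nC[k+1]≡[n+1]C[k+1] N j)) ⟩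
  (2+j) ℕ.* (Y ℕ.+ Z) ℕ.+ (1+j) ℕ.* (X ℕ.+ Y)
    ≡⟨ solveℕ 4 (λ j X Y Z → (conℕ 2 ⊕ j) ⊛ (Y ⊕ Z) ⊕ (conℕ 1 ⊕ j) ⊛ (X ⊕ Y)
                        ≐ ((conℕ 2 ⊕ j) ⊛ Z ⊕ (conℕ 1 ⊕ j) ⊛ Y) ⊕ (Y ⊕ X) ⊕ ((conℕ 1 ⊕ j) ⊛ Y ⊕ j ⊛ X)) refl j X Y Z ⟩
  ((2+j) ℕ.* Z ℕ.+ (1+j) ℕ.* Y) ℕ.+ (Y ℕ.+ X) ℕ.+ ((1+j) ℕ.* Y ℕ.+ j ℕ.* X)
    ≡⟨ cong₂ (λ a b → a ℕ.+ (Y ℕ.+ X) ℕ.+ b) (absorption N (suc j)) (absorption N j) ⟩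
  N ℕ.* Y ℕ.+ (Y ℕ.+ X) ℕ.+ N ℕ.* X
    ≡⟨ solveℕ 3 (λ N X Y → N ⊛ Y ⊕ (Y ⊕ X) ⊕ N ⊛ X ≐ (conℕ 1 ⊕ N) ⊛ (X ⊕ Y)) refl N X Y ⟩
  suc N ℕ.* (X ℕ.+ Y)
    ≡⟨ cong (suc N ℕ.*_) (nCk+nC[k+1]≡[n+1]C[k+1] N j) ⟩
  suc N ℕ.* (suc N C suc j) ∎
  where
  open ≡-Reasoning
  X Y Z 1+j 2+j : ℕ
  X = N C j
  Y = N C suc j
  Z = N C suc (suc j)
  1+j = suc j
  2+j = suc (suc j)

binom-absorption : ∀ k′ n → fromℕ (suc n) * binom (suc k′) (suc n) ≡ (fromℕ (suc k′) - fromℕ (suc n)) * binom (suc k′) n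
binom-absorption k′ n = begin
  fromℕ (suc n) * c₁
    ≡⟨ solve 3 (λ a b d → a :* b := (a :* b :+ d) :- d) refl (fromℕ (suc n)) c₁ (fromℕ n * c₀) ⟩
  (fromℕ (suc n) * c₁ + fromℕ n * c₀) - fromℕ n * c₀
    ≡⟨ cong (_- fromℕ n * c₀) absorptionℚ ⟩
  fromℕ k′ * c₀ - fromℕ n * c₀
    ≡⟨ solve 3 (λ k n c → k :* c :- n :* c := ((con 1ℚ :+ k) :- (con 1ℚ :+ n)) :* c) refl (fromℕ k′) (fromℕ n) c₀ ⟩
  ((1ℚ + fromℕ k′) - (1ℚ + fromℕ n)) * c₀
    ≡⟨ cong₂ (λ a b → (a - b) * c₀) (fromℕ-suc k′) (fromℕ-suc n) ⟨
  (fromℕ (suc k′) - fromℕ (suc n)) * c₀ ∎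
  where
  open ≡-Reasoning
  c₀ c₁ : ℚ
  c₀ = fromℕ (k′ C n)
  c₁ = fromℕ (k′ C suc n)
  absorptionℚ : fromℕ (suc n) * c₁ + fromℕ n * c₀ ≡ fromℕ k′ * c₀
  absorptionℚ = begin
    fromℕ (suc n) * c₁ + fromℕ n * c₀
      ≡⟨ cong₂ _+_ (fromℕ-* (suc n) (k′ C suc n)) (fromℕ-* n (k′ C n)) ⟨
    fromℕ (suc n ℕ.* (k′ C suc n)) + fromℕ (n ℕ.* (k′ C n))
      ≡⟨ fromℕ-+ (suc n ℕ.* (k′ C suc n)) (n ℕ.* (k′ C n)) ⟨
    fromℕ (suc n ℕ.* (k′ C suc n) ℕ.+ n ℕ.* (k′ C n))
      ≡⟨ cong fromℕ (absorption k′ n) ⟩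
    fromℕ (k′ ℕ.* (k′ C n))
      ≡⟨ fromℕ-* k′ (k′ C n) ⟩
    fromℕ k′ * c₀ ∎

-- d/dt (t u) = u + t du/dt, on weights for ℚ[t]
ddtQᵀ-suc : ∀ ψ i → ddtQᵀ ψ (suc i) ≡ ψ i + ddtQᵀ (λ l → ψ (suc l)) i
ddtQᵀ-suc ψ zero    = solve 2 (λ x y → con 1ℚ :* x := x :+ con 0ℚ :* y) refl (ψ 0) (ψ 1)
ddtQᵀ-suc ψ (suc i) = begin
  fromℕ (suc (suc i)) * ψ (suc i)         ≡⟨ cong (_* ψ (suc i)) (fromℕ-suc (suc i)) ⟩
  (1ℚ + fromℕ (suc i)) * ψ (suc i)        ≡⟨ solve 2 (λ n x → (con 1ℚ :+ n) :* x := x :+ n :* x) refl (fromℕ (suc i)) (ψ (suc i)) ⟩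
  ψ (suc i) + fromℕ (suc i) * ψ (suc i)   ∎
  where open ≡-Reasoning

ddt-P : ∀ k′ n ψ → ⟪ ddtQᵀ ψ ∣ P (suc k′) (suc n) ⟫ ≡ (fromℕ (suc k′) - fromℕ (suc n)) * ⟪ ψ ∣ P (suc k′) n ⟫
ddt-P k′ zero    ψ = trans (onP-suc (suc k′) 0 (ddtQᵀ ψ))
  (solve 3 (λ c y K → con 0ℚ :- con 0ℚ :+ c :* (con 0ℚ :* y) := (K :- con 1ℚ) :* con 0ℚ) refl
         (binom (suc k′) 0) (ψ 0) (fromℕ (suc k′)))
ddt-P k′ (suc n) ψ = begin
  ⟪ ddtQᵀ ψ ∣ P k (suc (suc n)) ⟫
    ≡⟨ onP-suc k (suc n) (ddtQᵀ ψ) ⟩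
  ⟪ ddtQᵀ ψ ∣ P k (suc n) ⟫ - ⟪ (λ l → ddtQᵀ ψ (suc l)) ∣ P k (suc n) ⟫ + binom k (suc n) * ddtQᵀ ψ (suc n)
    ≡⟨ cong₂ (λ u v → u - v + binom k (suc n) * ddtQᵀ ψ (suc n)) (ddt-P k′ n ψ) shifted ⟩
  (K - N) * a - ((a - b + binom k n * ψ n) + (K - N) * b) + binom k (suc n) * (N * ψ n)
    ≡⟨ cong (λ z → (K - N) * a - ((a - b + binom k n * ψ n) + (K - N) * b) + z) absorbed ⟩
  (K - N) * a - ((a - b + binom k n * ψ n) + (K - N) * b) + ((K - N) * binom k n) * ψ n
    ≡⟨ solve 6 (λ K N a b p c → (K :- N) :* a :- ((a :- b :+ c :* p) :+ (K :- N) :* b) :+ ((K :- N) :* c) :* p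
                               := (K :- (con 1ℚ :+ N)) :* (a :- b :+ c :* p)) refl K N a b (ψ n) (binom k n) ⟩
  (K - (1ℚ + N)) * (a - b + binom k n * ψ n)
    ≡⟨ cong₂ (λ u v → (K - u) * v) (fromℕ-suc (suc n)) (onP-suc k n ψ) ⟨
  (K - fromℕ (suc (suc n))) * ⟪ ψ ∣ P k (suc n) ⟫ ∎
  where
  open ≡-Reasoning
  k : ℕ
  k = suc k′
  K N a b : ℚ
  K = fromℕ k
  N = fromℕ (suc n)
  a = ⟪ ψ ∣ P k n ⟫
  b = ⟪ (λ l → ψ (suc l)) ∣ P k n ⟫
  shifted : ⟪ (λ l → ddtQᵀ ψ (suc l)) ∣ P k (suc n) ⟫ ≡ (a - b + binom k n * ψ n) + (K - N) * b
  shifted = begin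
    ⟪ (λ l → ddtQᵀ ψ (suc l)) ∣ P k (suc n) ⟫
      ≡⟨ pair-cong (ddtQᵀ-suc ψ) (P k (suc n)) ⟩
    ⟪ (λ l → ψ l + ddtQᵀ (λ i → ψ (suc i)) l) ∣ P k (suc n) ⟫
      ≡⟨ pair-+ ψ (ddtQᵀ (λ i → ψ (suc i))) (P k (suc n)) ⟩
    ⟪ ψ ∣ P k (suc n) ⟫ + ⟪ ddtQᵀ (λ i → ψ (suc i)) ∣ P k (suc n) ⟫
      ≡⟨ cong₂ _+_ (onP-suc k n ψ) (ddt-P k′ n (λ i → ψ (suc i))) ⟩
    (a - b + binom k n * ψ n) + (K - N) * b ∎
  absorbed : binom k (suc n) * (N * ψ n) ≡ ((K - N) * binom k n) * ψ n
  absorbed = trans (solve 3 (λ c N p → c :* (N :* p) := (N :* c) :* p) refl (binom k (suc n)) N (ψ n))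
                   (cong (_* ψ n) (binom-absorption k′ n))

onSt-x : ∀ φ k n → ⟪ φ ∣ St (x k n) ⟫ ≡ sumL (onSt φ) (xWords k n)
onSt-x φ k n = trans (pair-St φ (x k n))
  (trans (sumL-map _ _ (xWords k n)) (sumL-cong (λ w → ℚP.*-identityˡ (onSt φ w)) (xWords k n)))

onZ : (Monomial → ℚ) → ℕ → ℕ → ℚ
onZ φ k i = φ (i , k ∷ [])

on-Pz : ∀ φ k p → ⟪ φ ∣ ((- 1ℚ , 0) ∷ []) · (p · zH k) ⟫ ≡ - ⟪ onZ φ k ∣ p ⟫
on-Pz φ k p = begin
  ⟪ φ ∣ ((- 1ℚ , 0) ∷ []) · (p · zH k) ⟫
    ≡⟨ pair-·-term (- 1ℚ) 0 φ (p · zH k) ⟩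
  - 1ℚ * ⟪ φ ∣ p · zH k ⟫
    ≡⟨ cong (- 1ℚ *_) (trans (pair-· φ p (zH k)) (pair-cong on-zH p)) ⟩
  - 1ℚ * ⟪ onZ φ k ∣ p ⟫
    ≡⟨ solve 1 (λ y → con (- 1ℚ) :* y := :- y) refl ⟪ onZ φ k ∣ p ⟫ ⟩
  - ⟪ onZ φ k ∣ p ⟫ ∎
  where
  open ≡-Reasoning
  on-zH : ∀ i → ⟪ raise i φ ∣ zH k ⟫ ≡ onZ φ k i
  on-zH i = trans (cong (λ j → 1ℚ * φ (j , k ∷ []) + 0ℚ) (ℕP.+-identityʳ i))
                  (solve 1 (λ y → con 1ℚ :* y :+ con 0ℚ := y) refl (onZ φ k i))

ddt-gen : ∀ k′ n φ → ⟪ ddtᵀ φ ∣ gen (suc k′) (suc n) ⟫ ≡ (fromℕ (suc k′) - fromℕ (suc n)) * ⟪ φ ∣ gen (suc k′) n ⟫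
ddt-gen k′ n φ = begin
  ⟪ ddtᵀ φ ∣ gen k (suc n) ⟫
    ≡⟨ pair-++ (ddtᵀ φ) (St (x k (suc n))) _ ⟩
  ⟪ ddtᵀ φ ∣ St (x k (suc n)) ⟫ + ⟪ ddtᵀ φ ∣ ((- 1ℚ , 0) ∷ []) · (P k (suc n) · zH k) ⟫
    ≡⟨ cong₂ _+_ word-part (on-Pz (ddtᵀ φ) k (P k (suc n))) ⟩
  r * s + - ⟪ ddtQᵀ (onZ φ k) ∣ P k (suc n) ⟫
    ≡⟨ cong (λ z → r * s + - z) (ddt-P k′ n (onZ φ k)) ⟩
  r * s + - (r * ⟪ onZ φ k ∣ P k n ⟫)
    ≡⟨ solve 3 (λ r s a → r :* s :+ (:- (r :* a)) := r :* (s :+ (:- a))) refl r s ⟪ onZ φ k ∣ P k n ⟫ ⟩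
  r * (s + - ⟪ onZ φ k ∣ P k n ⟫)
    ≡⟨ cong₂ (λ u v → r * (u + v)) (onSt-x φ k n) (on-Pz φ k (P k n)) ⟨
  r * (⟪ φ ∣ St (x k n) ⟫ + ⟪ φ ∣ ((- 1ℚ , 0) ∷ []) · (P k n · zH k) ⟫)
    ≡⟨ cong (r *_) (pair-++ φ (St (x k n)) _) ⟨
  r * ⟪ φ ∣ gen k n ⟫ ∎
  where
  open ≡-Reasoning
  k : ℕ
  k = suc k′
  r s : ℚ
  r = fromℕ k - fromℕ (suc n)
  s = sumL (onSt φ) (xWords k n)
  word-part : ⟪ ddtᵀ φ ∣ St (x k (suc n)) ⟫ ≡ r * s
  word-part = begin
    ⟪ ddtᵀ φ ∣ St (x k (suc n)) ⟫                     ≡⟨ onSt-x (ddtᵀ φ) k (suc n) ⟩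
    sumL (onSt (ddtᵀ φ)) (xWords k (suc n))            ≡⟨ sumL-cong (λ w → ddt-onSt w φ) (xWords k (suc n)) ⟩
    sumL (contractSum (onSt φ)) (xWords k (suc n))     ≡⟨ contract-xWords k′ n (onSt φ) ⟩
    r * s                                              ∎

ddtQ : QT → QT
ddtQ p = map (λ t → (proj₁ t * fromℕ (proj₂ t) , proj₂ t ∸ 1)) p

scaleQ : ℚ → QT → QT
scaleQ r p = map (λ t → (r * proj₁ t , proj₂ t)) p

pair-ddtQ : ∀ ψ p → ⟪ ψ ∣ ddtQ p ⟫ ≡ ⟪ ddtQᵀ ψ ∣ p ⟫
pair-ddtQ ψ p = trans (sumL-map _ _ p) (sumL-cong (λ t → ℚP.*-assoc (proj₁ t) (fromℕ (proj₂ t)) (ψ (proj₂ t ∸ 1))) p)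

pair-scaleQ : ∀ r ψ p → ⟪ ψ ∣ scaleQ r p ⟫ ≡ r * ⟪ ψ ∣ p ⟫
pair-scaleQ r ψ p = trans (sumL-map _ _ p) (trans (sumL-cong (λ t → ℚP.*-assoc r (proj₁ t) (ψ (proj₂ t))) p) (sumL-* r _ p))

-- d/dt (t^i u) = i t^(i−1) u + t^i du/dt
raise-ddt : ∀ φ i m → raise i (ddtᵀ φ) m ≡ fromℕ i * raise (i ∸ 1) φ m + ddtᵀ (raise i φ) m
raise-ddt φ zero    (zero , w)  = solve 2 (λ x y → con 0ℚ :* x := con 0ℚ :* y :+ con 0ℚ :* y) refl (φ (0 , w)) (φ (0 , w))
raise-ddt φ zero    (suc j , w) = solve 3 (λ n x y → n :* x := con 0ℚ :* y :+ n :* x) refl (fromℕ (suc j)) (φ (j , w)) (φ (suc j , w))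
raise-ddt φ (suc i) (zero , w)  = begin
  fromℕ (suc i ℕ.+ 0) * y                 ≡⟨ cong (λ a → fromℕ a * y) (ℕP.+-identityʳ (suc i)) ⟩
  fromℕ (suc i) * y                       ≡⟨ solve 2 (λ x z → x := x :+ con 0ℚ :* z) refl (fromℕ (suc i) * y) (φ (suc i ℕ.+ 0 , w)) ⟩
  fromℕ (suc i) * y + 0ℚ * φ (suc i ℕ.+ 0 , w) ∎
  where open ≡-Reasoning
        y : ℚ
        y = φ (i ℕ.+ 0 , w)
raise-ddt φ (suc i) (suc j , w) = begin
  fromℕ (suc i ℕ.+ suc j) * φ (i ℕ.+ suc j , w)     ≡⟨ cong₂ (λ a b → a * φ (b , w)) (fromℕ-+ (suc i) (suc j)) (ℕP.+-suc i j) ⟩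
  (fromℕ (suc i) + fromℕ (suc j)) * y              ≡⟨ ℚP.*-distribʳ-+ y (fromℕ (suc i)) (fromℕ (suc j)) ⟩
  fromℕ (suc i) * y + fromℕ (suc j) * y            ≡⟨ cong (λ b → fromℕ (suc i) * φ (b , w) + fromℕ (suc j) * y) (ℕP.+-suc i j) ⟨
  fromℕ (suc i) * φ (i ℕ.+ suc j , w) + fromℕ (suc j) * y ∎
  where open ≡-Reasoning
        y : ℚ
        y = φ (suc (i ℕ.+ j) , w)

ddt-· : ∀ φ p g → ⟪ ddtᵀ φ ∣ p · g ⟫ ≡ ⟪ φ ∣ ddtQ p · g ⟫ + ⟪ (λ i → ⟪ ddtᵀ (raise i φ) ∣ g ⟫) ∣ p ⟫
ddt-· φ p g = begin
  ⟪ ddtᵀ φ ∣ p · g ⟫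
    ≡⟨ pair-· (ddtᵀ φ) p g ⟩
  ⟪ (λ i → ⟪ raise i (ddtᵀ φ) ∣ g ⟫) ∣ p ⟫
    ≡⟨ pair-cong product p ⟩
  ⟪ (λ i → fromℕ i * ⟪ raise (i ∸ 1) φ ∣ g ⟫ + ⟪ ddtᵀ (raise i φ) ∣ g ⟫) ∣ p ⟫
    ≡⟨ pair-+ (ddtQᵀ (λ i → ⟪ raise i φ ∣ g ⟫)) (λ i → ⟪ ddtᵀ (raise i φ) ∣ g ⟫) p ⟩
  ⟪ ddtQᵀ (λ i → ⟪ raise i φ ∣ g ⟫) ∣ p ⟫ + ⟪ (λ i → ⟪ ddtᵀ (raise i φ) ∣ g ⟫) ∣ p ⟫
    ≡⟨ cong (_+ ⟪ (λ i → ⟪ ddtᵀ (raise i φ) ∣ g ⟫) ∣ p ⟫) (trans (pair-· φ (ddtQ p) g) (pair-ddtQ _ p)) ⟨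
  ⟪ φ ∣ ddtQ p · g ⟫ + ⟪ (λ i → ⟪ ddtᵀ (raise i φ) ∣ g ⟫) ∣ p ⟫ ∎
  where
  open ≡-Reasoning
  product : ∀ i → ⟪ raise i (ddtᵀ φ) ∣ g ⟫ ≡ fromℕ i * ⟪ raise (i ∸ 1) φ ∣ g ⟫ + ⟪ ddtᵀ (raise i φ) ∣ g ⟫
  product i = trans (pair-cong (raise-ddt φ i) g)
    (trans (pair-+ _ _ g) (cong (_+ ⟪ ddtᵀ (raise i φ) ∣ g ⟫) (pair-* (fromℕ i) (raise (i ∸ 1) φ) g)))

module Combination (k′ : ℕ) where

  k : ℕ
  k = suc k′

  combination : (ℕ → QT) → H1t
  combination d = concatMap (λ n → d n · gen k n) (map suc (upTo k′))

  ddtCoeffs : (ℕ → QT) → ℕ → QT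
  ddtCoeffs d n = ddtQ (d n) ++ scaleQ (fromℕ k - fromℕ (suc n)) (d (suc n))

  module _ (d : ℕ → QT) (φ : Monomial → ℚ) where

    own : ℕ → ℚ
    own j = ⟪ φ ∣ ddtQ (d (suc j)) · gen k (suc j) ⟫

    lowered : ℕ → ℚ
    lowered n = (fromℕ k - fromℕ n) * ⟪ φ ∣ d n · gen k (n ∸ 1) ⟫

    ddt-term : ∀ j → ⟪ ddtᵀ φ ∣ d (suc j) · gen k (suc j) ⟫ ≡ own j + lowered (suc j)
    ddt-term j = trans (ddt-· φ (d (suc j)) (gen k (suc j))) (cong (own j +_) (begin
      ⟪ (λ i → ⟪ ddtᵀ (raise i φ) ∣ gen k (suc j) ⟫) ∣ d (suc j) ⟫
        ≡⟨ pair-cong (λ i → ddt-gen k′ j (raise i φ)) (d (suc j)) ⟩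
      ⟪ (λ i → r * ⟪ raise i φ ∣ gen k j ⟫) ∣ d (suc j) ⟫
        ≡⟨ pair-* r _ (d (suc j)) ⟩
      r * ⟪ (λ i → ⟪ raise i φ ∣ gen k j ⟫) ∣ d (suc j) ⟫
        ≡⟨ cong (r *_) (pair-· φ (d (suc j)) (gen k j)) ⟨
      lowered (suc j) ∎))
      where
      open ≡-Reasoning
      r : ℚ
      r = fromℕ k - fromℕ (suc j)

    ddtCoeffs-term : ∀ j → ⟪ φ ∣ ddtCoeffs d (suc j) · gen k (suc j) ⟫ ≡ own j + lowered (suc (suc j))
    ddtCoeffs-term j = begin
      ⟪ φ ∣ ddtCoeffs d (suc j) · gen k (suc j) ⟫
        ≡⟨ pair-· φ (ddtCoeffs d (suc j)) (gen k (suc j)) ⟩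
      ⟪ ψ ∣ ddtQ (d (suc j)) ++ scaleQ r (d (suc (suc j))) ⟫
        ≡⟨ pair-++ ψ (ddtQ (d (suc j))) _ ⟩
      ⟪ ψ ∣ ddtQ (d (suc j)) ⟫ + ⟪ ψ ∣ scaleQ r (d (suc (suc j))) ⟫
        ≡⟨ cong₂ _+_ (sym (pair-· φ (ddtQ (d (suc j))) (gen k (suc j))))
                     (trans (pair-scaleQ r ψ (d (suc (suc j))))
                            (cong (r *_) (sym (pair-· φ (d (suc (suc j))) (gen k (suc j)))))) ⟩
      own j + lowered (suc (suc j)) ∎
      where
      open ≡-Reasoning
      r : ℚ
      r = fromℕ k - fromℕ (suc (suc j))
      ψ : ℕ → ℚ
      ψ i = ⟪ raise i φ ∣ gen k (suc j) ⟫

    -- the boundary terms vanish: gen k 0 = 0, and k − k = 0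
    lowered-1 : lowered 1 ≡ 0ℚ
    lowered-1 = trans (cong ((fromℕ k - fromℕ 1) *_) (trans (pair-· φ (d 1) (gen k 0)) (pair-zero (d 1))))
                      (ℚP.*-zeroʳ (fromℕ k - fromℕ 1))

    lowered-k : lowered k ≡ 0ℚ
    lowered-k = trans (cong (_* ⟪ φ ∣ d k · gen k k′ ⟫) (ℚP.+-inverseʳ (fromℕ k))) (ℚP.*-zeroˡ ⟪ φ ∣ d k · gen k k′ ⟫)

    -- shifting the index of the lowered terms matches both sides term by term
    ddt-combination : ⟪ ddtᵀ φ ∣ combination d ⟫ ≡ ⟪ φ ∣ combination (ddtCoeffs d) ⟫
    ddt-combination = begin
      ⟪ ddtᵀ φ ∣ combination d ⟫
        ≡⟨ trans (pair-concatMap (ddtᵀ φ) _ (map suc (upTo k′))) (sumL-map _ suc (upTo k′)) ⟩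
      sumL (λ j → ⟪ ddtᵀ φ ∣ d (suc j) · gen k (suc j) ⟫) (upTo k′)
        ≡⟨ trans (sumL-cong ddt-term (upTo k′)) (sumL-+ own (λ j → lowered (suc j)) (upTo k′)) ⟩
      sumL own (upTo k′) + sumL (λ j → lowered (suc j)) (upTo k′)
        ≡⟨ cong (sumL own (upTo k′) +_) (sumL-shift (λ j → lowered (suc j)) k′ lowered-1 lowered-k) ⟩
      sumL own (upTo k′) + sumL (λ j → lowered (suc (suc j))) (upTo k′)
        ≡⟨ trans (sumL-cong ddtCoeffs-term (upTo k′)) (sumL-+ own (λ j → lowered (suc (suc j))) (upTo k′)) ⟨
      sumL (λ j → ⟪ φ ∣ ddtCoeffs d (suc j) · gen k (suc j) ⟫) (upTo k′)
        ≡⟨ trans (pair-concatMap φ _ (map suc (upTo k′))) (sumL-map _ suc (upTo k′)) ⟨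
      ⟪ φ ∣ combination (ddtCoeffs d) ⟫ ∎
      where open ≡-Reasoning

ddt-indicator : ∀ j w m → ddtᵀ (indicator j w) m ≡ fromℕ (suc j) * indicator (suc j) w m
ddt-indicator j w (zero , v)  = trans (ℚP.*-zeroˡ (indicator j w (0 , v))) (sym (ℚP.*-zeroʳ (fromℕ (suc j))))
ddt-indicator j w (suc i , v) with i ≡ᵇ j in i≡ᵇj
... | true  = cong (λ n → fromℕ (suc n) * (if v ≟w w then 1ℚ else 0ℚ)) (ℕP.≡ᵇ⇒≡ i j (subst T (sym i≡ᵇj) tt))
... | false = trans (ℚP.*-zeroʳ (fromℕ (suc i))) (sym (ℚP.*-zeroʳ (fromℕ (suc j))))

coeff-ddt : ∀ f w j → coeff (ddt f) w j ≡ fromℕ (suc j) * coeff f w (suc j)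
coeff-ddt f w j = begin
  coeff (ddt f) w j                                 ≡⟨ coeff-pair (ddt f) w j ⟩
  ⟪ indicator j w ∣ ddt f ⟫                         ≡⟨ pair-ddt (indicator j w) f ⟩
  ⟪ ddtᵀ (indicator j w) ∣ f ⟫                      ≡⟨ pair-cong (ddt-indicator j w) f ⟩
  ⟪ (λ m → fromℕ (suc j) * indicator (suc j) w m) ∣ f ⟫ ≡⟨ pair-* (fromℕ (suc j)) (indicator (suc j) w) f ⟩
  fromℕ (suc j) * ⟪ indicator (suc j) w ∣ f ⟫       ≡⟨ cong (fromℕ (suc j) *_) (coeff-pair f w (suc j)) ⟨
  fromℕ (suc j) * coeff f w (suc j)                 ∎
  where open ≡-Reasoning

ddt-cong : ∀ f g → f ≈ g → ddt f ≈ ddt g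
ddt-cong f g f≈g w j = trans (coeff-ddt f w j) (trans (cong (fromℕ (suc j) *_) (f≈g w (suc j))) (sym (coeff-ddt g w j)))

lemma5p2 : (k : ℕ) → 2 ≤ k → (f : H1t) → InNSF k f → InNSF k (ddt f)
lemma5p2 zero    () f
lemma5p2 (suc k′) _  f (c , f≈comb) = ddtCoeffs c , λ w j →
  trans (ddt-cong f (combination c) f≈comb w j)
        (≈-from-pairings (ddt (combination c)) (combination (ddtCoeffs c))
          (λ φ → trans (pair-ddt φ (combination c)) (ddt-combination c φ)) w j)
  where open Combination k′
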